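{- Let $n$ and $k$ be integers with $2\le k\le n-1$. There is a map $\Phi_{n,k}$ with the following property. For every $k$-vertex-connected graph $H$ on $n$ vertices and every ordering of $V(H)$, the $(\le n-k)$-graphlet degree distribution of $H$ equals $\Phi_{n,k}$ applied to the $(n-k+1)$-graphlet degree distribution of $H$. In other words, the $(n-k+1)$-graphlet degree sequences of a $k$-vertex-connected graph determine its $(\le n-k)$-graphlet degree sequences.
   Context: All graphs are finite, simple and undirected. Let $H$ be a graph on $n$ vertices. A graphlet is a pair $(G,r)$ with $G$ a connected graph with at least one and fewer than $n$ vertices and $r\in V(G)$. Two graphlets are isomorphic if some isomorphism of the graphs maps root to root; graphlets are taken up to isomorphism in a fixed enumeration. For $v\in V(H)$, the graphlet degree of $v$ with respect to $(G,r)$ is the number of sets $S\subseteq V(H)$ with $v\in S$ such that some isomorphism $H[S]\to G$ maps $v$ to $r$. The $m$-gdd (respectively $(\le m)$-gdd) of $H$ is the matrix with rows indexed by the vertices of $H$ and columns by graphlet classes with exactly $m$ (respectively at most $m$) vertices. Its entries are the graphlet degrees. -}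

module Defs where

open import Data.Nat using (ℕ; zero; suc; _≤_; _<_)
open import Data.Fin using (Fin; zero; suc; _≟_)
open import Data.Bool using (Bool; true; false; _∧_; not; if_then_else_)
open import Data.List using (List; []; _∷_; map; concatMap; length; filterᵇ; allFin)
open import Data.Bool.ListAction using (all; any)
open import Data.Product using (Σ; _×_)
open import Relation.Nullary.Decidable using (⌊_⌋)
open import Relation.Binary.PropositionalEquality using (_≡_)

-- A finite simple undirected graph on the vertex set Fin n
-- (the vertex set comes with its ordering 0,1,…,n-1).
record Graph (n : ℕ) : Set where
  field
    adj    : Fin n → Fin n → Bool
    sym    : ∀ i j → adj i j ≡ adj j i
    irrefl : ∀ i → adj i i ≡ false
open Graph public

VSet : ℕ → Set
VSet n = Fin n → Bool

size : ∀ {n} → VSet n → ℕ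
size {n} X = length (filterᵇ X (allFin n))

data Reach {n : ℕ} (G : Graph n) (A : VSet n) : Fin n → Fin n → Set where
  here : ∀ {u} → A u ≡ true → Reach G A u u
  step : ∀ {u w x} → A u ≡ true → adj G u w ≡ true → Reach G A w x → Reach G A u x

-- G is connected (vertex set nonempty is guaranteed separately where needed).
Connected : ∀ {n} → Graph n → Set
Connected {n} G = ∀ (u w : Fin n) → Reach G (λ _ → true) u w

KConnected : ∀ {n} → ℕ → Graph n → Set
KConnected {n} k G =
  k < n × (∀ (X : VSet n) → size X < k →
            ∀ (u w : Fin n) → X u ≡ false → X w ≡ false →
            Reach G (λ x → not (X x)) u w)

-- A graphlet with m vertices: a connected graph on Fin m with a root.
-- (m ≥ 1 is forced by the existence of the root.)
record Graphlet (m : ℕ) : Set where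
  field
    graph     : Graph m
    root      : Fin m
    connected : Connected graph
open Graphlet public

GraphletUpTo : ℕ → Set
GraphletUpTo m = Σ ℕ (λ j → j ≤ m × Graphlet j)

allFuns : ∀ {A : Set} (m : ℕ) → List A → List (Fin m → A)
allFuns zero    xs = (λ ()) ∷ []
allFuns (suc m) xs =
  concatMap (λ f → map (λ a → λ { zero → a ; (suc i) → f i }) xs) (allFuns m xs)

private
  eqF : ∀ {n} → Fin n → Fin n → Bool
  eqF a b = ⌊ a ≟ b ⌋

  eqB : Bool → Bool → Bool
  eqB true  b = b
  eqB false b = not b

  forallF : ∀ n → (Fin n → Bool) → Bool
  forallF n p = all p (allFin n)

  existsF : ∀ n → (Fin n → Bool) → Bool
  existsF n p = any p (allFin n)

-- isoWitness H S G r v f: f : Fin m → Fin n is a bijection from V(G) onto S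
-- with f r = v that preserves adjacency and non-adjacency; i.e. the inverse
-- of f is an isomorphism H[S] → G mapping v to r.
isoWitness : ∀ {n m} → Graph n → VSet n → Graph m → Fin m → Fin n → (Fin m → Fin n) → Bool
isoWitness {n} {m} H S G r v f =
  eqF (f r) v
  ∧ forallF m (λ i → forallF m (λ j → eqF i j ∨' not (eqF (f i) (f j))))
  ∧ forallF n (λ u → eqB (S u) (existsF m (λ i → eqF (f i) u)))
  ∧ forallF m (λ i → forallF m (λ j → eqB (adj G i j) (adj H (f i) (f j))))
  where
    _∨'_ : Bool → Bool → Bool
    true  ∨' _ = true
    false ∨' b = b

-- Graphlet degree of v in H with respect to (G , r): the number of sets
-- S ⊆ V(H) with v ∈ S such that some isomorphism H[S] → G maps v to r.
graphletDegree : ∀ {n m} → Graph n → Graphlet m → Fin n → ℕ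
graphletDegree {n} {m} H g v =
  length (filterᵇ (λ S → S v ∧ any (isoWitness H S (graph g) (root g) v) (allFuns m (allFin n)))
                  (allFuns n (true ∷ false ∷ [])))

gdd : ∀ {n} (m : ℕ) → Graph n → Fin n → Graphlet m → ℕ
gdd m H v g = graphletDegree H g v

gddUpTo : ∀ {n} (m : ℕ) → Graph n → Fin n → GraphletUpTo m → ℕ
gddUpTo m H v (j Data.Product., (_ Data.Product., g)) = graphletDegree H g v

-- Count rooted induced embeddings instead of induced subgraphs. The number #Emb H G r v of
-- injective maps V(G) → V(H) sending r to v and preserving adjacency and non-adjacency is the
-- graphlet degree of v for (G , r) times the number #Aut G r of automorphisms of (G , r).
-- An embedding of a j-vertex graph G extends by each of the n − j vertices outside its image,
-- and the extended graph is determined by the neighbourhood of the new vertex; hence the sum of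
-- #Emb over all one-vertex extensions of G is (n − j) · #Emb H G r v, and embedding counts
-- descend from N = n − k + 1 vertices to fewer. At N vertices they are read off the N-gdd:
-- the n − N < k vertices outside the image of an embedding do not disconnect H, so only
-- connected graphs embed, and those are graphlets.
module Submission where

open import Defs renaming (sym to adj-sym)
open import Data.Bool using (Bool; true; false; _∧_; not; T)
import Data.Bool.Properties as Bool
open import Data.Bool.ListAction using (all; any)
open import Data.Empty using (⊥; ⊥-elim)
open import Data.Fin using (Fin; zero; suc; _≟_; punchOut)
import Data.Fin.Properties as Fin
open import Data.List using (List; []; _∷_; _++_; map; concatMap; length; filterᵇ; allFin)
open import Data.List.Properties using (map-tabulate)
open import Data.List.Membership.Propositional using (_∈_)
open import Data.List.Membership.Propositional.Properties using (∈-allFin)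
import Data.List.Relation.Unary.All as All
open import Data.List.Relation.Unary.All.Properties using (all⁺; all⁻)
open import Data.List.Relation.Unary.Any as Any using (here; there)
open import Data.List.Relation.Unary.Any.Properties using (any⁺; any⁻)
open import Data.Nat using (ℕ; zero; suc; _+_; _*_; _∸_; _≤_; _<_; _/_; z≤n; s≤s; NonZero; >-nonZero)
open import Data.Nat.DivMod using (m*n/n≡m)
open import Data.Nat.Properties hiding (_≟_)
open import Algebra.Properties.CommutativeSemigroup +-commutativeSemigroup using (interchange)
open import Data.Product using (Σ; ∃; _×_; _,_; proj₁; proj₂; map₂; uncurry)
open import Data.Sum using (_⊎_; inj₁; inj₂)
open import Data.Unit using (tt)
open import Data.Vec.Functional using () renaming (_∷_ to _∷ᶠ_)
open import Data.Vec.Functional.Properties using (≗-dec; ∷-injective)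
open import Function using (_∘_; id; Equivalence)
open import Function.Definitions using (Injective)
open import Relation.Binary using (Decidable; DecidableEquality; _Preserves_⟶_)
open import Relation.Binary.PropositionalEquality
open import Relation.Nullary using (Dec; yes; no; ¬_; contradiction)
open import Relation.Nullary.Decidable
  using (⌊_⌋; map′; _×-dec_; _→-dec_; toWitness; fromWitness; T?; decidable-stable; isYes≗does; dec-true; dec-false)

private
  variable
    A B : Set
    n m j : ℕ

χ : Bool → ℕ
χ true  = 1
χ false = 0

χ-∧ : ∀ a b → χ (a ∧ b) ≡ χ a * χ b
χ-∧ true  b = sym (+-identityʳ (χ b))
χ-∧ false b = refl

χ≤1 : ∀ b → χ b ≤ 1
χ≤1 true  = s≤s z≤n
χ≤1 false = z≤n

χ-not : ∀ b → χ (not b) + χ b ≡ 1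
χ-not true  = refl
χ-not false = refl

∑ : List A → (A → ℕ) → ℕ
∑ []       F = 0
∑ (x ∷ xs) F = F x + ∑ xs F

infix 5 ∑
syntax ∑ xs (λ x → e) = ∑[ x ∈ xs ] e

∑-cong : ∀ {F G : A → ℕ} → (∀ x → F x ≡ G x) → ∀ xs → ∑ xs F ≡ ∑ xs G
∑-cong F≗G []       = refl
∑-cong F≗G (x ∷ xs) = cong₂ _+_ (F≗G x) (∑-cong F≗G xs)

∑-zero : ∀ (xs : List A) → ∑[ x ∈ xs ] 0 ≡ 0
∑-zero []       = refl
∑-zero (x ∷ xs) = ∑-zero xs

∑-+ : ∀ (F G : A → ℕ) xs → ∑[ x ∈ xs ] (F x + G x) ≡ ∑ xs F + ∑ xs G
∑-+ F G []       = refl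
∑-+ F G (x ∷ xs) = trans (cong (F x + G x +_) (∑-+ F G xs)) (interchange (F x) (G x) (∑ xs F) (∑ xs G))

∑-*ˡ : ∀ c (F : A → ℕ) xs → ∑[ x ∈ xs ] (c * F x) ≡ c * ∑ xs F
∑-*ˡ c F []       = sym (*-zeroʳ c)
∑-*ˡ c F (x ∷ xs) = trans (cong (c * F x +_) (∑-*ˡ c F xs)) (sym (*-distribˡ-+ c (F x) (∑ xs F)))

∑-*ʳ : ∀ c (F : A → ℕ) xs → ∑[ x ∈ xs ] (F x * c) ≡ ∑ xs F * c
∑-*ʳ c F xs = begin
  ∑[ x ∈ xs ] (F x * c) ≡⟨ ∑-cong (λ x → *-comm (F x) c) xs ⟩
  ∑[ x ∈ xs ] (c * F x) ≡⟨ ∑-*ˡ c F xs ⟩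
  c * ∑ xs F            ≡⟨ *-comm c (∑ xs F) ⟩
  ∑ xs F * c            ∎
  where open ≡-Reasoning

∑-++ : ∀ (F : A → ℕ) xs ys → ∑ (xs ++ ys) F ≡ ∑ xs F + ∑ ys F
∑-++ F []       ys = refl
∑-++ F (x ∷ xs) ys = trans (cong (F x +_) (∑-++ F xs ys)) (sym (+-assoc (F x) (∑ xs F) (∑ ys F)))

∑-mono-≤ : ∀ {F G : A → ℕ} → (∀ x → F x ≤ G x) → ∀ xs → ∑ xs F ≤ ∑ xs G
∑-mono-≤ F≤G []       = z≤n
∑-mono-≤ F≤G (x ∷ xs) = +-mono-≤ (F≤G x) (∑-mono-≤ F≤G xs)

∑-mono-< : ∀ {F G : A → ℕ} → (∀ x → F x ≤ G x) → ∀ {x₀ xs} → x₀ ∈ xs → F x₀ < G x₀ → ∑ xs F < ∑ xs G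
∑-mono-< F≤G {xs = x ∷ xs} (here refl)  Fx₀<Gx₀ = +-mono-<-≤ Fx₀<Gx₀ (∑-mono-≤ F≤G xs)
∑-mono-< F≤G {xs = x ∷ xs} (there x₀∈) Fx₀<Gx₀ = +-mono-≤-< (F≤G x) (∑-mono-< F≤G x₀∈ Fx₀<Gx₀)

length-filterᵇ : ∀ (p : A → Bool) xs → length (filterᵇ p xs) ≡ ∑[ x ∈ xs ] χ (p x)
length-filterᵇ p []       = refl
length-filterᵇ p (x ∷ xs) with p x
... | true  = cong suc (length-filterᵇ p xs)
... | false = length-filterᵇ p xs

∑-comm : ∀ (F : A → B → ℕ) xs ys → ∑[ x ∈ xs ] ∑[ y ∈ ys ] F x y ≡ ∑[ y ∈ ys ] ∑[ x ∈ xs ] F x y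
∑-comm F []       ys = sym (∑-zero ys)
∑-comm F (x ∷ xs) ys = trans (cong (∑ ys (F x) +_) (∑-comm F xs ys)) (sym (∑-+ (F x) _ ys))

∑-map : ∀ (F : B → ℕ) (g : A → B) xs → ∑ (map g xs) F ≡ ∑ xs (F ∘ g)
∑-map F g []       = refl
∑-map F g (x ∷ xs) = cong (F (g x) +_) (∑-map F g xs)

∑-concatMap : ∀ (F : B → ℕ) (g : A → List B) xs → ∑ (concatMap g xs) F ≡ ∑[ x ∈ xs ] ∑ (g x) F
∑-concatMap F g []       = refl
∑-concatMap F g (x ∷ xs) = trans (∑-++ F (g x) (concatMap g xs)) (cong (∑ (g x) F +_) (∑-concatMap F g xs))

∑-allFin-suc : ∀ n (F : Fin (suc n) → ℕ) → ∑ (allFin (suc n)) F ≡ F zero + (∑[ i ∈ allFin n ] F (suc i))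
∑-allFin-suc n F = cong (F zero +_) (trans (cong (λ xs → ∑ xs F) (sym (map-tabulate (λ i → i) suc))) (∑-map F suc (allFin n)))

∑-allFin-1 : ∀ n → ∑[ i ∈ allFin n ] 1 ≡ n
∑-allFin-1 zero    = refl
∑-allFin-1 (suc n) = trans (∑-allFin-suc n (λ _ → 1)) (cong suc (∑-allFin-1 n))

-- Double counting of the pairs (a , b) with b ≈₂ φ a, equivalently a ≈₁ ψ b.
∑-χ-bijection : ∀ (L₁ : List A) (L₂ : List B) (_≈₁_ : A → A → Bool) (_≈₂_ : B → B → Bool) →
  (∀ a → ∑[ x ∈ L₁ ] χ (x ≈₁ a) ≡ 1) → (∀ b → ∑[ y ∈ L₂ ] χ (y ≈₂ b) ≡ 1) →
  ∀ (p : A → Bool) (q : B → Bool) (φ : A → B) (ψ : B → A) →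
  (∀ a b → (p a ∧ (b ≈₂ φ a)) ≡ (q b ∧ (a ≈₁ ψ b))) →
  ∑[ a ∈ L₁ ] χ (p a) ≡ ∑[ b ∈ L₂ ] χ (q b)
∑-χ-bijection L₁ L₂ _≈₁_ _≈₂_ single₁ single₂ p q φ ψ same-graph = begin
  ∑[ a ∈ L₁ ] χ (p a)                                 ≡⟨ ∑-cong (λ a → spread (p a) L₂ (_≈₂ φ a) (single₂ (φ a))) L₁ ⟩
  ∑[ a ∈ L₁ ] ∑[ b ∈ L₂ ] χ (p a) * χ (b ≈₂ φ a)      ≡⟨ ∑-comm _ L₁ L₂ ⟩
  ∑[ b ∈ L₂ ] ∑[ a ∈ L₁ ] χ (p a) * χ (b ≈₂ φ a)      ≡⟨ ∑-cong (λ b → ∑-cong (λ a → swap-graph a b) L₁) L₂ ⟩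
  ∑[ b ∈ L₂ ] ∑[ a ∈ L₁ ] χ (q b) * χ (a ≈₁ ψ b)      ≡⟨ ∑-cong (λ b → sym (spread (q b) L₁ (_≈₁ ψ b) (single₁ (ψ b)))) L₂ ⟩
  ∑[ b ∈ L₂ ] χ (q b)                                 ∎
  where
  open ≡-Reasoning
  spread : ∀ {C : Set} c (L : List C) (e : C → Bool) → ∑[ x ∈ L ] χ (e x) ≡ 1 → χ c ≡ ∑[ x ∈ L ] χ c * χ (e x)
  spread c L e one = sym (trans (∑-*ˡ (χ c) (χ ∘ e) L) (trans (cong (χ c *_) one) (*-identityʳ (χ c))))
  swap-graph : ∀ a b → χ (p a) * χ (b ≈₂ φ a) ≡ χ (q b) * χ (a ≈₁ ψ b)
  swap-graph a b = trans (sym (χ-∧ (p a) _)) (trans (cong χ (same-graph a b)) (χ-∧ (q b) _))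

∑-χ-∉ : ∀ (p : A → Bool) xs → ¬ T (any p xs) → ∑[ x ∈ xs ] χ (p x) ≡ 0
∑-χ-∉ p []       _    = refl
∑-χ-∉ p (x ∷ xs) none with p x
... | true  = ⊥-elim (none tt)
... | false = ∑-χ-∉ p xs none

⌊⌋-⇔ : ∀ {P Q : Set} → (P → Q) → (Q → P) → (p? : Dec P) (q? : Dec Q) → ⌊ p? ⌋ ≡ ⌊ q? ⌋
⌊⌋-⇔ to from (yes p) (yes q) = refl
⌊⌋-⇔ to from (yes p) (no ¬q) = contradiction (to p) ¬q
⌊⌋-⇔ to from (no ¬p) (yes q) = contradiction (from q) ¬p
⌊⌋-⇔ to from (no ¬p) (no ¬q) = refl

⌊⌋-×-dec : ∀ {P Q : Set} (p? : Dec P) (q? : Dec Q) → ⌊ p? ×-dec q? ⌋ ≡ ⌊ p? ⌋ ∧ ⌊ q? ⌋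
⌊⌋-×-dec (yes p) (yes q) = refl
⌊⌋-×-dec (yes p) (no ¬q) = refl
⌊⌋-×-dec (no ¬p) q?      = refl

⌊⌋-∧-⇔ : ∀ {P Q P′ Q′ : Set} → (P × Q → P′ × Q′) → (P′ × Q′ → P × Q) →
  (p? : Dec P) (q? : Dec Q) (p′? : Dec P′) (q′? : Dec Q′) → ⌊ p? ⌋ ∧ ⌊ q? ⌋ ≡ ⌊ p′? ⌋ ∧ ⌊ q′? ⌋
⌊⌋-∧-⇔ to from p? q? p′? q′? = begin
  ⌊ p? ⌋ ∧ ⌊ q? ⌋        ≡⟨ ⌊⌋-×-dec p? q? ⟨
  ⌊ p? ×-dec q? ⌋        ≡⟨ ⌊⌋-⇔ to from (p? ×-dec q?) (p′? ×-dec q′?) ⟩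
  ⌊ p′? ×-dec q′? ⌋      ≡⟨ ⌊⌋-×-dec p′? q′? ⟩
  ⌊ p′? ⌋ ∧ ⌊ q′? ⌋      ∎
  where open ≡-Reasoning

⌊⌋-true : ∀ {P : Set} (p? : Dec P) → P → ⌊ p? ⌋ ≡ true
⌊⌋-true p? p = trans (isYes≗does p?) (dec-true p? p)

⌊⌋-false : ∀ {P : Set} (p? : Dec P) → ¬ P → ⌊ p? ⌋ ≡ false
⌊⌋-false p? ¬p = trans (isYes≗does p?) (dec-false p? ¬p)

T⇔⇒≡⌊⌋ : ∀ {P : Set} {b} → (T b → P) → (P → T b) → (p? : Dec P) → b ≡ ⌊ p? ⌋
T⇔⇒≡⌊⌋ {b = true}  to from (yes p) = refl
T⇔⇒≡⌊⌋ {b = true}  to from (no ¬p) = contradiction (to tt) ¬p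
T⇔⇒≡⌊⌋ {b = false} to from (yes p) = ⊥-elim (from p)
T⇔⇒≡⌊⌋ {b = false} to from (no ¬p) = refl

¬T-∧ : ∀ {a b} → ¬ T (a ∧ b) → ¬ T a ⊎ ¬ T b
¬T-∧ {true}  ¬t = inj₂ ¬t
¬T-∧ {false} ¬t = inj₁ (λ ())

T-all-allFin : ∀ {p : Fin n → Bool} → T (all p (allFin n)) → ∀ i → T (p i)
T-all-allFin {n} {p} t i = All.lookup (all⁺ p (allFin n) t) (∈-allFin i)

¬T-all-allFin : ∀ {p : Fin n → Bool} → ¬ T (all p (allFin n)) → ∃ λ i → ¬ T (p i)
¬T-all-allFin {n} {p} ¬t = Fin.¬∀⟶∃¬ n (T ∘ p) (T? ∘ p) (λ t → ¬t (all⁻ p {allFin n} (All.tabulate (λ {i} _ → t i))))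

T-any⇒∃ : ∀ (p : A → Bool) xs → T (any p xs) → ∃ λ x → T (p x)
T-any⇒∃ p xs t = Any.satisfied (any⁻ p xs t)

-- allFuns builds its functions with its own pattern lambda, which agrees with _∷ᶠ_ only pointwise.
∑-allFuns-suc : ∀ m (xs : List A) (F : (Fin (suc m) → A) → ℕ) → F Preserves _≗_ ⟶ _≡_ →
  ∑ (allFuns (suc m) xs) F ≡ ∑[ f ∈ allFuns m xs ] ∑[ a ∈ xs ] F (a ∷ᶠ f)
∑-allFuns-suc m xs F F-resp =
  trans (∑-concatMap F _ (allFuns m xs))
        (∑-cong (λ f → trans (∑-map F _ xs) (∑-cong (λ a → F-resp (λ { zero → refl ; (suc i) → refl })) xs))
                (allFuns m xs))

module Enumeration (_≟_ : DecidableEquality A) (xs : List A)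
                   (enumerates : ∀ a → ∑[ x ∈ xs ] χ ⌊ x ≟ a ⌋ ≡ 1) where

  ∑-single : ∀ b (F : A → ℕ) → ∑[ a ∈ xs ] χ ⌊ a ≟ b ⌋ * F a ≡ F b
  ∑-single b F = begin
    ∑[ a ∈ xs ] χ ⌊ a ≟ b ⌋ * F a     ≡⟨ ∑-cong at-b xs ⟩
    ∑[ a ∈ xs ] χ ⌊ a ≟ b ⌋ * F b     ≡⟨ ∑-*ʳ (F b) _ xs ⟩
    (∑[ a ∈ xs ] χ ⌊ a ≟ b ⌋) * F b   ≡⟨ cong (_* F b) (enumerates b) ⟩
    1 * F b                           ≡⟨ *-identityˡ (F b) ⟩
    F b                               ∎
    where
    open ≡-Reasoning
    at-b : ∀ a → χ ⌊ a ≟ b ⌋ * F a ≡ χ ⌊ a ≟ b ⌋ * F b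
    at-b a with a ≟ b
    ... | yes refl = refl
    ... | no _     = refl

  private
    _≗?_ : ∀ {m} → Decidable (_≗_ {A = Fin m} {B = A})
    _≗?_ = ≗-dec _≟_

  χ-≗?-∷ : ∀ {m} a (f : Fin m → A) h → χ ⌊ (a ∷ᶠ f) ≗? h ⌋ ≡ χ ⌊ a ≟ h zero ⌋ * χ ⌊ f ≗? (h ∘ suc) ⌋
  χ-≗?-∷ a f h = begin
    χ ⌊ (a ∷ᶠ f) ≗? h ⌋                             ≡⟨ cong χ (⌊⌋-⇔ ∷-injective join ((a ∷ᶠ f) ≗? h) (a ≟ h zero ×-dec f ≗? (h ∘ suc))) ⟩
    χ ⌊ a ≟ h zero ×-dec f ≗? (h ∘ suc) ⌋           ≡⟨ cong χ (⌊⌋-×-dec (a ≟ h zero) (f ≗? (h ∘ suc))) ⟩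
    χ (⌊ a ≟ h zero ⌋ ∧ ⌊ f ≗? (h ∘ suc) ⌋)         ≡⟨ χ-∧ ⌊ a ≟ h zero ⌋ ⌊ f ≗? (h ∘ suc) ⌋ ⟩
    χ ⌊ a ≟ h zero ⌋ * χ ⌊ f ≗? (h ∘ suc) ⌋         ∎
    where
    open ≡-Reasoning
    join : a ≡ h zero × f ≗ h ∘ suc → (a ∷ᶠ f) ≗ h
    join (eq₀ , eq) zero    = eq₀
    join (eq₀ , eq) (suc i) = eq i

  ∑-allFuns-single : ∀ m (h : Fin m → A) (F : (Fin m → A) → ℕ) → F Preserves _≗_ ⟶ _≡_ →
    ∑[ f ∈ allFuns m xs ] χ ⌊ f ≗? h ⌋ * F f ≡ F h
  ∑-allFuns-single zero    h F F-resp = trans (+-identityʳ _) (trans (+-identityʳ _) (F-resp λ ()))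
  ∑-allFuns-single (suc m) h F F-resp = begin
    ∑[ f ∈ allFuns (suc m) xs ] χ ⌊ f ≗? h ⌋ * F f
      ≡⟨ ∑-allFuns-suc m xs _ (λ {f} {f′} eq → cong₂ _*_ (cong χ (⌊⌋-⇔ (λ e i → trans (sym (eq i)) (e i)) (λ e i → trans (eq i) (e i)) (f ≗? h) (f′ ≗? h))) (F-resp eq)) ⟩
    ∑[ f ∈ allFuns m xs ] ∑[ a ∈ xs ] χ ⌊ (a ∷ᶠ f) ≗? h ⌋ * F (a ∷ᶠ f)
      ≡⟨ ∑-cong (λ f → ∑-cong (λ a → split-χ a f) xs) (allFuns m xs) ⟩
    ∑[ f ∈ allFuns m xs ] ∑[ a ∈ xs ] χ ⌊ a ≟ h zero ⌋ * (χ ⌊ f ≗? (h ∘ suc) ⌋ * F (a ∷ᶠ f))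
      ≡⟨ ∑-cong (λ f → ∑-single (h zero) (λ a → χ ⌊ f ≗? (h ∘ suc) ⌋ * F (a ∷ᶠ f))) (allFuns m xs) ⟩
    ∑[ f ∈ allFuns m xs ] χ ⌊ f ≗? (h ∘ suc) ⌋ * F (h zero ∷ᶠ f)
      ≡⟨ ∑-allFuns-single m (h ∘ suc) (λ f → F (h zero ∷ᶠ f)) (λ eq → F-resp (λ { zero → refl ; (suc i) → eq i })) ⟩
    F (h zero ∷ᶠ (h ∘ suc))
      ≡⟨ F-resp (λ { zero → refl ; (suc i) → refl }) ⟩
    F h ∎
    where
    open ≡-Reasoning
    split-χ : ∀ a f → χ ⌊ (a ∷ᶠ f) ≗? h ⌋ * F (a ∷ᶠ f) ≡ χ ⌊ a ≟ h zero ⌋ * (χ ⌊ f ≗? (h ∘ suc) ⌋ * F (a ∷ᶠ f))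
    split-χ a f = trans (cong (_* F (a ∷ᶠ f)) (χ-≗?-∷ a f h)) (*-assoc (χ ⌊ a ≟ h zero ⌋) (χ ⌊ f ≗? (h ∘ suc) ⌋) (F (a ∷ᶠ f)))

  allFuns-enumerates : ∀ m (h : Fin m → A) → ∑[ f ∈ allFuns m xs ] χ ⌊ f ≗? h ⌋ ≡ 1
  allFuns-enumerates m h = trans (∑-cong (λ f → sym (*-identityʳ _)) (allFuns m xs)) (∑-allFuns-single m h (λ _ → 1) (λ _ → refl))

allFin-enumerates : ∀ n (j : Fin n) → ∑[ i ∈ allFin n ] χ ⌊ i Fin.≟ j ⌋ ≡ 1
allFin-enumerates (suc n) zero    = trans (∑-allFin-suc n (λ i → χ ⌊ i Fin.≟ zero ⌋)) (cong suc (∑-zero (allFin n)))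
allFin-enumerates (suc n) (suc j) = begin
  ∑[ i ∈ allFin (suc n) ] χ ⌊ i Fin.≟ suc j ⌋    ≡⟨ ∑-allFin-suc n (λ i → χ ⌊ i Fin.≟ suc j ⌋) ⟩
  ∑[ i ∈ allFin n ] χ ⌊ suc i Fin.≟ suc j ⌋      ≡⟨ ∑-cong (λ i → cong χ (⌊⌋-⇔ Fin.suc-injective (cong suc) (suc i Fin.≟ suc j) (i Fin.≟ j))) (allFin n) ⟩
  ∑[ i ∈ allFin n ] χ ⌊ i Fin.≟ j ⌋              ≡⟨ allFin-enumerates n j ⟩
  1                                              ∎
  where open ≡-Reasoning

Bool-enumerates : ∀ b → ∑[ c ∈ true ∷ false ∷ [] ] χ ⌊ c Bool.≟ b ⌋ ≡ 1
Bool-enumerates true  = refl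
Bool-enumerates false = refl

module FinFuns {k} = Enumeration (_≟_ {k}) (allFin k) (allFin-enumerates k)
module BoolFuns = Enumeration Bool._≟_ (true ∷ false ∷ []) Bool-enumerates

-- Spelled as in isoWitness, whose set condition is then literally S ≗ image f.
image : (Fin m → Fin n) → VSet n
image {m} f u = any (λ i → ⌊ f i ≟ u ⌋) (allFin m)

image-sound : ∀ (f : Fin m → Fin n) {u} → image f u ≡ true → ∃ λ i → f i ≡ u
image-sound {m} f fu = map₂ toWitness (Any.satisfied (any⁻ _ (allFin m) (Equivalence.from Bool.T-≡ fu)))

image-∋ : ∀ (f : Fin m → Fin n) i → image f (f i) ≡ true
image-∋ f i = Equivalence.to Bool.T-≡ (any⁺ _ (Any.map (λ { refl → fromWitness refl }) (∈-allFin i)))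

image≡⌊any?⌋ : ∀ (f : Fin m → Fin n) u → image f u ≡ ⌊ Fin.any? (λ i → f i ≟ u) ⌋
image≡⌊any?⌋ f u = T⇔⇒≡⌊⌋ (image-sound f ∘ Equivalence.to Bool.T-≡)
                          (λ { (i , refl) → Equivalence.from Bool.T-≡ (image-∋ f i) }) _

image-∘-surjective : ∀ (f : Fin m → Fin n) (σ : Fin m → Fin m) → (∀ i → ∃ λ j → σ j ≡ i) → image (f ∘ σ) ≗ image f
image-∘-surjective f σ σ-onto u = begin
  image (f ∘ σ) u                          ≡⟨ image≡⌊any?⌋ (f ∘ σ) u ⟩
  ⌊ Fin.any? (λ j → f (σ j) ≟ u) ⌋         ≡⟨ ⌊⌋-⇔ (λ (j , eq) → σ j , eq) from _ _ ⟩
  ⌊ Fin.any? (λ i → f i ≟ u) ⌋             ≡⟨ image≡⌊any?⌋ f u ⟨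
  image f u                                ∎
  where
  open ≡-Reasoning
  from : (∃ λ i → f i ≡ u) → ∃ λ j → f (σ j) ≡ u
  from (i , fi≡u) with σ-onto i
  ... | j , refl = j , fi≡u

image-≗ : ∀ {f f′ : Fin m → Fin n} → f ≗ f′ → image f ≗ image f′
image-≗ {f = f} {f′} f≗f′ u = begin
  image f u                          ≡⟨ image≡⌊any?⌋ f u ⟩
  ⌊ Fin.any? (λ i → f i ≟ u) ⌋       ≡⟨ ⌊⌋-⇔ (λ (i , eq) → i , trans (sym (f≗f′ i)) eq) (λ (i , eq) → i , trans (f≗f′ i) eq) _ _ ⟩
  ⌊ Fin.any? (λ i → f′ i ≟ u) ⌋      ≡⟨ image≡⌊any?⌋ f′ u ⟨
  image f′ u                         ∎
  where open ≡-Reasoning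

injective⇒surjective : ∀ (σ : Fin m → Fin m) → Injective _≡_ _≡_ σ → ∀ i → ∃ λ j → σ j ≡ i
injective⇒surjective {suc m} σ σ-inj i with Fin.any? (λ j → σ j ≟ i)
... | yes hit = hit
... | no miss = contradiction (Fin.injective⇒≤ punched-injective) (<-irrefl refl)
  where
  -- Missing i, σ followed by punching out i injects Fin (suc m) into Fin m.
  avoids : ∀ j → i ≢ σ j
  avoids j i≡σj = miss (j , sym i≡σj)
  punched-injective : Injective _≡_ _≡_ (λ j → punchOut (avoids j))
  punched-injective {j} {k} eq = σ-inj (Fin.punchOut-injective (avoids j) (avoids k) eq)

module _ (f : Fin m → Fin n) (default : Fin m) where

  preimage : Fin n → Fin m
  preimage u with Fin.any? (λ i → f i ≟ u)
  ... | yes (i , _) = i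
  ... | no _        = default

  preimage-sound : ∀ {u} → (∃ λ i → f i ≡ u) → f (preimage u) ≡ u
  preimage-sound {u} hit with Fin.any? (λ i → f i ≟ u)
  ... | yes (i , fi≡u) = fi≡u
  ... | no miss        = contradiction hit miss

  preimage-∘ : Injective _≡_ _≡_ f → ∀ i → preimage (f i) ≡ i
  preimage-∘ f-inj i = f-inj (preimage-sound (i , refl))

χ-image : ∀ (f : Fin m → Fin n) → Injective _≡_ _≡_ f → ∀ u → χ (image f u) ≡ ∑[ i ∈ allFin m ] χ ⌊ f i ≟ u ⌋
χ-image {m} f f-inj u rewrite image≡⌊any?⌋ f u with Fin.any? (λ i → f i ≟ u)
... | yes (i₀ , refl) = sym (trans (∑-cong (λ i → cong χ (⌊⌋-⇔ f-inj (cong f) (f i ≟ f i₀) (i ≟ i₀))) (allFin m))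
                                   (allFin-enumerates m i₀))
... | no miss = sym (trans (∑-cong (λ i → cong χ (⌊⌋-false (f i ≟ u) (λ fi≡u → miss (i , fi≡u)))) (allFin m))
                           (∑-zero (allFin m)))

∑-χ-image : ∀ (f : Fin m → Fin n) → Injective _≡_ _≡_ f → ∑[ u ∈ allFin n ] χ (image f u) ≡ m
∑-χ-image {m} {n} f f-inj = begin
  ∑[ u ∈ allFin n ] χ (image f u)                        ≡⟨ ∑-cong (χ-image f f-inj) (allFin n) ⟩
  ∑[ u ∈ allFin n ] ∑[ i ∈ allFin m ] χ ⌊ f i ≟ u ⌋      ≡⟨ ∑-comm (λ u i → χ ⌊ f i ≟ u ⌋) (allFin n) (allFin m) ⟩
  ∑[ i ∈ allFin m ] ∑[ u ∈ allFin n ] χ ⌊ f i ≟ u ⌋      ≡⟨ ∑-cong (λ i → trans (∑-cong (λ u → cong χ (⌊⌋-⇔ sym sym (f i ≟ u) (u ≟ f i))) (allFin n)) (allFin-enumerates n (f i))) (allFin m) ⟩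
  ∑[ i ∈ allFin m ] 1                                    ≡⟨ ∑-allFin-1 m ⟩
  m                                                      ∎
  where open ≡-Reasoning

∑-χ-not-image : ∀ (f : Fin m → Fin n) → Injective _≡_ _≡_ f → ∑[ u ∈ allFin n ] χ (not (image f u)) ≡ n ∸ m
∑-χ-not-image {m} {n} f f-inj = begin
  outside                  ≡⟨ m+n∸n≡m outside m ⟨
  outside + m ∸ m          ≡⟨ cong (λ k → outside + k ∸ m) (∑-χ-image f f-inj) ⟨
  outside + inside ∸ m     ≡⟨ cong (_∸ m) partition ⟩
  n ∸ m                    ∎
  where
  open ≡-Reasoning
  outside inside : ℕ
  outside = ∑[ u ∈ allFin n ] χ (not (image f u))
  inside  = ∑[ u ∈ allFin n ] χ (image f u)
  partition : outside + inside ≡ n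
  partition = begin
    outside + inside                                             ≡⟨ ∑-+ (λ u → χ (not (image f u))) (λ u → χ (image f u)) (allFin n) ⟨
    ∑[ u ∈ allFin n ] (χ (not (image f u)) + χ (image f u))      ≡⟨ ∑-cong (λ u → χ-not (image f u)) (allFin n) ⟩
    ∑[ u ∈ allFin n ] 1                                          ≡⟨ ∑-allFin-1 n ⟩
    n                                                            ∎

-- Rooted induced embeddings

record IsEmbedding (H : Graph n) (G : Graph m) (r : Fin m) (v : Fin n) (f : Fin m → Fin n) : Set where
  field
    root↦ : f r ≡ v
    injective : Injective _≡_ _≡_ f
    adj-preserved : ∀ i j → adj G i j ≡ adj H (f i) (f j)

module _ (H : Graph n) (G : Graph m) (r : Fin m) (v : Fin n) where

  embedding? : ∀ f → Dec (IsEmbedding H G r v f)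
  embedding? f = map′ (λ (root , inj , adj) → record { root↦ = root ; injective = λ {i} {j} → inj {i} {j} ; adj-preserved = adj })
                      (λ e → IsEmbedding.root↦ e , (λ {i} {j} → IsEmbedding.injective e {i} {j}) , IsEmbedding.adj-preserved e)
                      (f r ≟ v ×-dec (injective? ×-dec adj-preserved?))
    where
    injective? : Dec (Injective _≡_ _≡_ f)
    injective? = map′ (λ inj {i} {j} → inj i j) (λ inj i j → inj {i} {j})
                      (Fin.all? λ i → Fin.all? λ j → f i ≟ f j →-dec i ≟ j)
    adj-preserved? : Dec (∀ i j → adj G i j ≡ adj H (f i) (f j))
    adj-preserved? = Fin.all? λ i → Fin.all? λ j → adj G i j Bool.≟ adj H (f i) (f j)

  embedding-≗ : ∀ {f f′} → f ≗ f′ → IsEmbedding H G r v f → IsEmbedding H G r v f′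
  embedding-≗ {f} {f′} f≗f′ e = record
    { root↦         = trans (sym (f≗f′ r)) root↦
    ; injective     = λ {i} {j} eq → injective (trans (f≗f′ i) (trans eq (sym (f≗f′ j))))
    ; adj-preserved = λ i j → trans (adj-preserved i j) (cong₂ (adj H) (f≗f′ i) (f≗f′ j))
    }
    where open IsEmbedding e

  χ-embedding-≗ : (λ f → χ ⌊ embedding? f ⌋) Preserves _≗_ ⟶ _≡_
  χ-embedding-≗ f≗f′ = cong χ (⌊⌋-⇔ (embedding-≗ f≗f′) (embedding-≗ (sym ∘ f≗f′)) _ _)

#Emb : Graph n → Graph m → Fin m → Fin n → ℕ
#Emb {n} {m} H G r v = ∑[ f ∈ allFuns m (allFin n) ] χ ⌊ embedding? H G r v f ⌋

#Aut : Graph m → Fin m → ℕ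
#Aut G r = #Emb G G r r

embedding-∘ : ∀ {k} {H : Graph n} {G : Graph m} {K : Graph k} {r v s f g} →
  IsEmbedding H G r v f → IsEmbedding G K s r g → IsEmbedding H K s v (f ∘ g)
embedding-∘ {H = H} {f = f} {g} e₁ e₂ = record
  { root↦         = trans (cong f (E₂.root↦)) E₁.root↦
  ; injective     = E₂.injective ∘ E₁.injective
  ; adj-preserved = λ i j → trans (E₂.adj-preserved i j) (E₁.adj-preserved (g i) (g j))
  }
  where
  module E₁ = IsEmbedding e₁
  module E₂ = IsEmbedding e₂

embedding-cancelˡ : ∀ {k} {H : Graph n} {G : Graph m} {K : Graph k} {r v s f g} →
  IsEmbedding H G r v f → IsEmbedding H K s v (f ∘ g) → IsEmbedding G K s r g
embedding-cancelˡ {f = f} {g} e₁ e₂ = record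
  { root↦         = E₁.injective (trans E₂.root↦ (sym E₁.root↦))
  ; injective     = E₂.injective ∘ cong f
  ; adj-preserved = λ i j → trans (E₂.adj-preserved i j) (sym (E₁.adj-preserved (g i) (g j)))
  }
  where
  module E₁ = IsEmbedding e₁
  module E₂ = IsEmbedding e₂

#Aut-positive : ∀ (G : Graph m) r → 0 < #Aut G r
#Aut-positive {m} G r = begin-strict
  0                                                                                 <⟨ s≤s z≤n ⟩
  1                                                                                 ≡⟨ cong χ (⌊⌋-true (embedding? G G r r id) identity) ⟨
  χ ⌊ embedding? G G r r id ⌋                                                        ≡⟨ FinFuns.∑-allFuns-single m id _ (χ-embedding-≗ G G r r) ⟨
  ∑[ σ ∈ allFuns m (allFin m) ] χ ⌊ ≗-dec _≟_ σ id ⌋ * χ ⌊ embedding? G G r r σ ⌋    ≤⟨ ∑-mono-≤ (λ σ → χ*≤ ⌊ ≗-dec _≟_ σ id ⌋ _) (allFuns m (allFin m)) ⟩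
  #Aut G r                                                                           ∎
  where
  open ≤-Reasoning
  identity : IsEmbedding G G r r id
  identity = record { root↦ = refl ; injective = id ; adj-preserved = λ _ _ → refl }
  χ*≤ : ∀ b x → χ b * x ≤ x
  χ*≤ true  x = ≤-reflexive (*-identityˡ x)
  χ*≤ false x = z≤n

#Emb-none : ∀ {H : Graph n} {G : Graph m} {r v} → (∀ f → ¬ IsEmbedding H G r v f) → #Emb H G r v ≡ 0
#Emb-none {n} {m} {H} {G} {r} {v} none =
  trans (∑-cong (λ f → cong χ (⌊⌋-false (embedding? H G r v f) (none f))) (allFuns m (allFin n)))
        (∑-zero (allFuns m (allFin n)))

-- isoWitness is built from helpers private to Defs, which cannot be named here: its conjuncts are
-- reached by with-abstraction on the Booleans they inspect (so the conjuncts stay unannotated),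
-- and each T-∧ split needs its left conjunct spelled out for unification to go through.
module _ {H : Graph n} {S : VSet n} {G : Graph m} {r : Fin m} {v : Fin n} {f : Fin m → Fin n} where

  isoWitness-sound : T (isoWitness H S G r v f) → IsEmbedding H G r v f × S ≗ image f
  isoWitness-sound w = record { root↦ = toWitness root-t ; injective = inj ; adj-preserved = adj-ok } , set
    where
    root-t = proj₁ (Equivalence.to (Bool.T-∧ {⌊ f r ≟ v ⌋}) w)
    rest   = proj₂ (Equivalence.to (Bool.T-∧ {⌊ f r ≟ v ⌋}) w)
    inj-t  = proj₁ (Equivalence.to (Bool.T-∧ {all _ (allFin m)}) rest)
    rest′  = proj₂ (Equivalence.to (Bool.T-∧ {all _ (allFin m)}) rest)
    set-t  = proj₁ (Equivalence.to (Bool.T-∧ {all _ (allFin n)}) rest′)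
    adj-t  = proj₂ (Equivalence.to (Bool.T-∧ {all _ (allFin n)}) rest′)

    inj : Injective _≡_ _≡_ f
    inj {i} {j} fi≡fj with i ≟ j | T-all-allFin {m} (T-all-allFin {m} inj-t i) j
    ... | yes i≡j | _ = i≡j
    ... | no _    | t with f i ≟ f j
    ...   | yes _    = ⊥-elim t
    ...   | no fi≢fj = contradiction fi≡fj fi≢fj

    set : S ≗ image f
    set u with S u | T-all-allFin {n} set-t u
    ... | true  | t = sym (Equivalence.to Bool.T-≡ t)
    ... | false | t = sym (Equivalence.to Bool.T-not-≡ t)

    adj-ok : ∀ i j → adj G i j ≡ adj H (f i) (f j)
    adj-ok i j with adj G i j | adj H (f i) (f j) | T-all-allFin {m} (T-all-allFin {m} adj-t i) j
    ... | true  | true  | _ = refl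
    ... | false | false | _ = refl
    ... | true  | false | ()
    ... | false | true  | ()

  isoWitness-complete : IsEmbedding H G r v f → S ≗ image f → T (isoWitness H S G r v f)
  isoWitness-complete e S≗image = decidable-stable (T? _) refute
    where
    open IsEmbedding e
    refute : ¬ T (isoWitness H S G r v f) → ⊥
    refute ¬t with ¬T-∧ {⌊ f r ≟ v ⌋} ¬t
    ... | inj₁ ¬root = ¬root (fromWitness root↦)
    ... | inj₂ ¬rest with ¬T-∧ {all _ (allFin m)} ¬rest
    ...   | inj₁ ¬inj with ¬T-all-allFin {m} ¬inj
    ...     | i , ¬inj-i with ¬T-all-allFin {m} ¬inj-i
    ...       | j , ¬inj-ij with i ≟ j
    ...         | yes _ = ¬inj-ij tt
    ...         | no i≢j with f i ≟ f j
    ...           | yes fi≡fj = i≢j (injective fi≡fj)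
    ...           | no _      = ¬inj-ij tt
    refute ¬t | inj₂ ¬rest | inj₂ ¬rest′ with ¬T-∧ {all _ (allFin n)} ¬rest′
    ...   | inj₁ ¬set with ¬T-all-allFin {n} ¬set
    ...     | u , ¬set-u with S u | S≗image u
    ...       | true  | Su = ¬set-u (Equivalence.from Bool.T-≡ (sym Su))
    ...       | false | Su = ¬set-u (Equivalence.from Bool.T-not-≡ (sym Su))
    refute ¬t | inj₂ ¬rest | inj₂ ¬rest′ | inj₂ ¬adj with ¬T-all-allFin {m} ¬adj
    ...   | i , ¬adj-i with ¬T-all-allFin {m} ¬adj-i
    ...     | j , ¬adj-ij with adj G i j | adj H (f i) (f j) | adj-preserved i j
    ...       | true  | true  | _ = ¬adj-ij tt
    ...       | false | false | _ = ¬adj-ij tt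

  isoWitness≡ : isoWitness H S G r v f ≡ ⌊ embedding? H G r v f ⌋ ∧ ⌊ ≗-dec Bool._≟_ S (image f) ⌋
  isoWitness≡ = trans (T⇔⇒≡⌊⌋ isoWitness-sound (uncurry isoWitness-complete) (embedding? H G r v f ×-dec ≗-dec Bool._≟_ S (image f)))
                      (⌊⌋-×-dec (embedding? H G r v f) (≗-dec Bool._≟_ S (image f)))

-- Graphlet degrees as embedding counts

module _ (H : Graph n) (G : Graph m) (r : Fin m) (v : Fin n) where

  private
    maps : List (Fin m → Fin n)
    maps = allFuns m (allFin n)
    autos : List (Fin m → Fin m)
    autos = allFuns m (allFin m)
    sets : List (VSet n)
    sets = allFuns n (true ∷ false ∷ [])

  -- For a fixed image S of some f₀, the witnesses are exactly f₀ ∘ σ for σ an automorphism.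
  ∑-isoWitness : ∀ S f₀ → T (isoWitness H S G r v f₀) → ∑[ f ∈ maps ] χ (isoWitness H S G r v f) ≡ #Aut G r
  ∑-isoWitness S f₀ w₀ =
    ∑-χ-bijection maps autos (λ f f′ → ⌊ ≗-dec _≟_ f f′ ⌋) (λ σ σ′ → ⌊ ≗-dec _≟_ σ σ′ ⌋)
      (FinFuns.allFuns-enumerates m) (FinFuns.allFuns-enumerates m)
      (λ f → isoWitness H S G r v f) (λ σ → ⌊ embedding? G G r r σ ⌋) φ ψ correspondence
    where
    e₀ : IsEmbedding H G r v f₀
    e₀ = proj₁ (isoWitness-sound {H = H} {S} {G} {r} {v} {f₀} w₀)
    S≗image₀ : S ≗ image f₀
    S≗image₀ = proj₂ (isoWitness-sound {H = H} {S} {G} {r} {v} {f₀} w₀)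
    module E₀ = IsEmbedding e₀
    φ : (Fin m → Fin n) → (Fin m → Fin m)
    φ f = preimage f₀ r ∘ f
    ψ : (Fin m → Fin m) → (Fin m → Fin n)
    ψ σ = f₀ ∘ σ

    to : ∀ {f σ} → (IsEmbedding H G r v f × S ≗ image f) × σ ≗ φ f → IsEmbedding G G r r σ × f ≗ ψ σ
    to {f} {σ} ((e , S≗image) , σ≗φf) = embedding-cancelˡ e₀ (embedding-≗ H G r v f≗ψσ e) , f≗ψσ
      where
      f-in-image₀ : ∀ i → ∃ λ j → f₀ j ≡ f i
      f-in-image₀ i = image-sound f₀ (trans (sym (S≗image₀ (f i))) (trans (S≗image (f i)) (image-∋ f i)))
      f≗ψσ : f ≗ ψ σ
      f≗ψσ i = sym (trans (cong f₀ (σ≗φf i)) (preimage-sound f₀ r (f-in-image₀ i)))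

    from : ∀ {f σ} → IsEmbedding G G r r σ × f ≗ ψ σ → (IsEmbedding H G r v f × S ≗ image f) × σ ≗ φ f
    from {f} {σ} (eσ , f≗ψσ) = (embedding-≗ H G r v (sym ∘ f≗ψσ) (embedding-∘ e₀ eσ) , S≗image) , σ≗φf
      where
      S≗image : S ≗ image f
      S≗image u = begin
        S u              ≡⟨ S≗image₀ u ⟩
        image f₀ u       ≡⟨ image-∘-surjective f₀ σ (injective⇒surjective σ (IsEmbedding.injective eσ)) u ⟨
        image (ψ σ) u    ≡⟨ image-≗ f≗ψσ u ⟨
        image f u        ∎
        where open ≡-Reasoning
      σ≗φf : σ ≗ φ f
      σ≗φf i = sym (trans (cong (preimage f₀ r) (f≗ψσ i)) (preimage-∘ f₀ r E₀.injective (σ i)))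

    correspondence : ∀ f σ → (isoWitness H S G r v f ∧ ⌊ ≗-dec _≟_ σ (φ f) ⌋) ≡ (⌊ embedding? G G r r σ ⌋ ∧ ⌊ ≗-dec _≟_ f (ψ σ) ⌋)
    correspondence f σ = begin
      isoWitness H S G r v f ∧ ⌊ ≗-dec _≟_ σ (φ f) ⌋
        ≡⟨ cong (_∧ ⌊ ≗-dec _≟_ σ (φ f) ⌋) (isoWitness≡ {H = H} {S} {G} {r} {v} {f}) ⟩
      (⌊ embedding? H G r v f ⌋ ∧ ⌊ ≗-dec Bool._≟_ S (image f) ⌋) ∧ ⌊ ≗-dec _≟_ σ (φ f) ⌋
        ≡⟨ cong (_∧ ⌊ ≗-dec _≟_ σ (φ f) ⌋) (⌊⌋-×-dec (embedding? H G r v f) (≗-dec Bool._≟_ S (image f))) ⟨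
      ⌊ embedding? H G r v f ×-dec ≗-dec Bool._≟_ S (image f) ⌋ ∧ ⌊ ≗-dec _≟_ σ (φ f) ⌋
        ≡⟨ ⌊⌋-∧-⇔ (to {f} {σ}) from (embedding? H G r v f ×-dec ≗-dec Bool._≟_ S (image f)) (≗-dec _≟_ σ (φ f))
                  (embedding? G G r r σ) (≗-dec _≟_ f (ψ σ)) ⟩
      ⌊ embedding? G G r r σ ⌋ ∧ ⌊ ≗-dec _≟_ f (ψ σ) ⌋ ∎
      where open ≡-Reasoning

  ∑-isoWitness-per-set : ∀ S → ∑[ f ∈ maps ] χ (isoWitness H S G r v f) ≡ χ (S v ∧ any (isoWitness H S G r v) maps) * #Aut G r
  ∑-isoWitness-per-set S with any (isoWitness H S G r v) maps in found
  ... | false = trans (∑-χ-∉ (isoWitness H S G r v) maps (subst T found))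
                      (cong (λ b → χ b * #Aut G r) (sym (Bool.∧-zeroʳ (S v))))
  ... | true with T-any⇒∃ (isoWitness H S G r v) maps (subst T (sym found) tt)
  ...   | f₀ , w₀ = begin
    ∑[ f ∈ maps ] χ (isoWitness H S G r v f)    ≡⟨ ∑-isoWitness S f₀ w₀ ⟩
    #Aut G r                                    ≡⟨ *-identityˡ (#Aut G r) ⟨
    χ true * #Aut G r                           ≡⟨ cong (λ b → χ b * #Aut G r) (trans (Bool.∧-identityʳ (S v)) v∈S) ⟨
    χ (S v ∧ true) * #Aut G r                   ∎
    where
    open ≡-Reasoning
    sound₀ : IsEmbedding H G r v f₀ × S ≗ image f₀
    sound₀ = isoWitness-sound {H = H} {S} {G} {r} {v} {f₀} w₀
    v∈S : S v ≡ true
    v∈S = trans (proj₂ sound₀ v) (subst (λ u → image f₀ u ≡ true) (IsEmbedding.root↦ (proj₁ sound₀)) (image-∋ f₀ r))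

  #Emb-by-images : #Emb H G r v ≡ length (filterᵇ (λ S → S v ∧ any (isoWitness H S G r v) maps) sets) * #Aut G r
  #Emb-by-images = begin
    #Emb H G r v
      ≡⟨ ∑-cong unique-image maps ⟩
    ∑[ f ∈ maps ] ∑[ S ∈ sets ] χ (isoWitness H S G r v f)
      ≡⟨ ∑-comm (λ f S → χ (isoWitness H S G r v f)) maps sets ⟩
    ∑[ S ∈ sets ] ∑[ f ∈ maps ] χ (isoWitness H S G r v f)
      ≡⟨ ∑-cong ∑-isoWitness-per-set sets ⟩
    ∑[ S ∈ sets ] χ (S v ∧ any (isoWitness H S G r v) maps) * #Aut G r
      ≡⟨ ∑-*ʳ (#Aut G r) (λ S → χ (S v ∧ any (isoWitness H S G r v) maps)) sets ⟩
    (∑[ S ∈ sets ] χ (S v ∧ any (isoWitness H S G r v) maps)) * #Aut G r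
      ≡⟨ cong (_* #Aut G r) (length-filterᵇ (λ S → S v ∧ any (isoWitness H S G r v) maps) sets) ⟨
    length (filterᵇ (λ S → S v ∧ any (isoWitness H S G r v) maps) sets) * #Aut G r ∎
    where
    open ≡-Reasoning
    unique-image : ∀ f → χ ⌊ embedding? H G r v f ⌋ ≡ ∑[ S ∈ sets ] χ (isoWitness H S G r v f)
    unique-image f = sym (begin
      ∑[ S ∈ sets ] χ (isoWitness H S G r v f)
        ≡⟨ ∑-cong (λ S → trans (cong χ (isoWitness≡ {H = H} {S} {G} {r} {v} {f})) (χ-∧ ⌊ embedding? H G r v f ⌋ ⌊ ≗-dec Bool._≟_ S (image f) ⌋)) sets ⟩
      ∑[ S ∈ sets ] χ ⌊ embedding? H G r v f ⌋ * χ ⌊ ≗-dec Bool._≟_ S (image f) ⌋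
        ≡⟨ ∑-*ˡ (χ ⌊ embedding? H G r v f ⌋) (λ S → χ ⌊ ≗-dec Bool._≟_ S (image f) ⌋) sets ⟩
      χ ⌊ embedding? H G r v f ⌋ * (∑[ S ∈ sets ] χ ⌊ ≗-dec Bool._≟_ S (image f) ⌋)
        ≡⟨ cong (χ ⌊ embedding? H G r v f ⌋ *_) (BoolFuns.allFuns-enumerates n (image f)) ⟩
      χ ⌊ embedding? H G r v f ⌋ * 1
        ≡⟨ *-identityʳ _ ⟩
      χ ⌊ embedding? H G r v f ⌋ ∎)

graphletDegree*#Aut : ∀ (H : Graph n) (g : Graphlet m) v → graphletDegree H g v * #Aut (graph g) (root g) ≡ #Emb H (graph g) (root g) v
graphletDegree*#Aut H g v = sym (#Emb-by-images H (graph g) (root g) v)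

-- One-vertex extensions

-- The new vertex is zero and N lists its neighbours among the old ones.
extend : Graph j → (Fin j → Bool) → Graph (suc j)
extend G N = record { adj = adj′ ; sym = adj′-sym ; irrefl = adj′-irrefl }
  where
  adj′ : _ → _ → Bool
  adj′ zero    zero    = false
  adj′ zero    (suc i) = N i
  adj′ (suc i) zero    = N i
  adj′ (suc i) (suc k) = adj G i k
  adj′-sym : ∀ i k → adj′ i k ≡ adj′ k i
  adj′-sym zero    zero    = refl
  adj′-sym zero    (suc i) = refl
  adj′-sym (suc i) zero    = refl
  adj′-sym (suc i) (suc k) = adj-sym G i k
  adj′-irrefl : ∀ i → adj′ i i ≡ false
  adj′-irrefl zero    = refl
  adj′-irrefl (suc i) = irrefl G i

module _ (H : Graph n) (G : Graph j) (r : Fin j) (v : Fin n) where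

  neighbours : Fin n → (Fin j → Fin n) → Fin j → Bool
  neighbours a f i = adj H a (f i)

  embedding-∷-sound : ∀ {N a f} → IsEmbedding H (extend G N) (suc r) v (a ∷ᶠ f) →
    (IsEmbedding H G r v f × T (not (image f a))) × N ≗ neighbours a f
  embedding-∷-sound {N} {a} {f} e = (record { root↦ = root↦ ; injective = Fin.suc-injective ∘ injective ; adj-preserved = λ i k → adj-preserved (suc i) (suc k) } , a∉f) , λ i → adj-preserved zero (suc i)
    where
    open IsEmbedding e
    a∉f : T (not (image f a))
    a∉f = Equivalence.from Bool.T-not-≡ (Bool.¬-not λ a∈f → Fin.0≢1+n (injective (sym (proj₂ (image-sound f a∈f)))))

  embedding-∷-complete : ∀ {N a f} → (IsEmbedding H G r v f × T (not (image f a))) × N ≗ neighbours a f →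
    IsEmbedding H (extend G N) (suc r) v (a ∷ᶠ f)
  embedding-∷-complete {N} {a} {f} ((e , a∉f) , N≗) = record { root↦ = root↦ ; injective = inj ; adj-preserved = adj-ok }
    where
    open IsEmbedding e
    a≢f : ∀ i → f i ≢ a
    a≢f i fi≡a = subst (T ∘ not) (trans (cong (image f) (sym fi≡a)) (image-∋ f i)) a∉f
    inj : Injective _≡_ _≡_ (a ∷ᶠ f)
    inj {zero}  {zero}  _  = refl
    inj {zero}  {suc k} eq = ⊥-elim (a≢f k (sym eq))
    inj {suc i} {zero}  eq = ⊥-elim (a≢f i eq)
    inj {suc i} {suc k} eq = cong suc (injective eq)
    adj-ok : ∀ i k → adj (extend G N) i k ≡ adj H ((a ∷ᶠ f) i) ((a ∷ᶠ f) k)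
    adj-ok zero    zero    = sym (irrefl H a)
    adj-ok zero    (suc k) = N≗ k
    adj-ok (suc i) zero    = trans (N≗ i) (adj-sym H a (f i))
    adj-ok (suc i) (suc k) = adj-preserved i k

  private
    maps : List (Fin j → Fin n)
    maps = allFuns j (allFin n)
    nbrs : List (Fin j → Bool)
    nbrs = allFuns j (true ∷ false ∷ [])

  χ-embedding-∷ : ∀ N a f → χ ⌊ embedding? H (extend G N) (suc r) v (a ∷ᶠ f) ⌋
                           ≡ χ (⌊ embedding? H G r v f ⌋ ∧ not (image f a)) * χ ⌊ ≗-dec Bool._≟_ N (neighbours a f) ⌋
  χ-embedding-∷ N a f = begin
    χ ⌊ embedding? H (extend G N) (suc r) v (a ∷ᶠ f) ⌋
      ≡⟨ cong χ (⌊⌋-⇔ embedding-∷-sound embedding-∷-complete _ (outside? ×-dec ≗-dec Bool._≟_ N (neighbours a f))) ⟩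
    χ ⌊ outside? ×-dec ≗-dec Bool._≟_ N (neighbours a f) ⌋
      ≡⟨ cong χ (⌊⌋-×-dec outside? (≗-dec Bool._≟_ N (neighbours a f))) ⟩
    χ (⌊ outside? ⌋ ∧ ⌊ ≗-dec Bool._≟_ N (neighbours a f) ⌋)
      ≡⟨ χ-∧ ⌊ outside? ⌋ ⌊ ≗-dec Bool._≟_ N (neighbours a f) ⌋ ⟩
    χ ⌊ outside? ⌋ * χ ⌊ ≗-dec Bool._≟_ N (neighbours a f) ⌋
      ≡⟨ cong (λ b → χ b * χ ⌊ ≗-dec Bool._≟_ N (neighbours a f) ⌋) (trans (⌊⌋-×-dec (embedding? H G r v f) (T? (not (image f a)))) (cong (⌊ embedding? H G r v f ⌋ ∧_) (⌊T?⌋ (not (image f a))))) ⟩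
    χ (⌊ embedding? H G r v f ⌋ ∧ not (image f a)) * χ ⌊ ≗-dec Bool._≟_ N (neighbours a f) ⌋ ∎
    where
    open ≡-Reasoning
    outside? : Dec (IsEmbedding H G r v f × T (not (image f a)))
    outside? = embedding? H G r v f ×-dec T? (not (image f a))
    ⌊T?⌋ : ∀ b → ⌊ T? b ⌋ ≡ b
    ⌊T?⌋ true  = refl
    ⌊T?⌋ false = refl

  #Emb-extend : ∑[ N ∈ nbrs ] #Emb H (extend G N) (suc r) v ≡ #Emb H G r v * (n ∸ j)
  #Emb-extend = begin
    ∑[ N ∈ nbrs ] #Emb H (extend G N) (suc r) v
      ≡⟨ ∑-cong (λ N → ∑-allFuns-suc j (allFin n) _ (χ-embedding-≗ H (extend G N) (suc r) v)) nbrs ⟩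
    ∑[ N ∈ nbrs ] ∑[ f ∈ maps ] ∑[ a ∈ allFin n ] χ ⌊ embedding? H (extend G N) (suc r) v (a ∷ᶠ f) ⌋
      ≡⟨ ∑-cong (λ N → ∑-cong (λ f → ∑-cong (λ a → χ-embedding-∷ N a f) (allFin n)) maps) nbrs ⟩
    ∑[ N ∈ nbrs ] ∑[ f ∈ maps ] ∑[ a ∈ allFin n ] fresh f a * χ ⌊ ≗-dec Bool._≟_ N (neighbours a f) ⌋
      ≡⟨ ∑-comm _ nbrs maps ⟩
    ∑[ f ∈ maps ] ∑[ N ∈ nbrs ] ∑[ a ∈ allFin n ] fresh f a * χ ⌊ ≗-dec Bool._≟_ N (neighbours a f) ⌋
      ≡⟨ ∑-cong (λ f → ∑-comm _ nbrs (allFin n)) maps ⟩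
    ∑[ f ∈ maps ] ∑[ a ∈ allFin n ] ∑[ N ∈ nbrs ] fresh f a * χ ⌊ ≗-dec Bool._≟_ N (neighbours a f) ⌋
      ≡⟨ ∑-cong (λ f → ∑-cong (λ a → unique-neighbours f a) (allFin n)) maps ⟩
    ∑[ f ∈ maps ] ∑[ a ∈ allFin n ] fresh f a
      ≡⟨ ∑-cong ∑-fresh maps ⟩
    ∑[ f ∈ maps ] χ ⌊ embedding? H G r v f ⌋ * (n ∸ j)
      ≡⟨ ∑-*ʳ (n ∸ j) (λ f → χ ⌊ embedding? H G r v f ⌋) maps ⟩
    #Emb H G r v * (n ∸ j) ∎
    where
    open ≡-Reasoning
    fresh : (Fin j → Fin n) → Fin n → ℕ
    fresh f a = χ (⌊ embedding? H G r v f ⌋ ∧ not (image f a))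
    unique-neighbours : ∀ f a → ∑[ N ∈ nbrs ] fresh f a * χ ⌊ ≗-dec Bool._≟_ N (neighbours a f) ⌋ ≡ fresh f a
    unique-neighbours f a = begin
      ∑[ N ∈ nbrs ] fresh f a * χ ⌊ ≗-dec Bool._≟_ N (neighbours a f) ⌋   ≡⟨ ∑-*ˡ (fresh f a) _ nbrs ⟩
      fresh f a * (∑[ N ∈ nbrs ] χ ⌊ ≗-dec Bool._≟_ N (neighbours a f) ⌋) ≡⟨ cong (fresh f a *_) (BoolFuns.allFuns-enumerates j (neighbours a f)) ⟩
      fresh f a * 1                                                       ≡⟨ *-identityʳ (fresh f a) ⟩
      fresh f a                                                           ∎
    ∑-fresh : ∀ f → ∑[ a ∈ allFin n ] fresh f a ≡ χ ⌊ embedding? H G r v f ⌋ * (n ∸ j)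
    ∑-fresh f with embedding? H G r v f
    ... | yes e = trans (∑-χ-not-image f (IsEmbedding.injective e)) (sym (*-identityˡ (n ∸ j)))
    ... | no _  = ∑-zero (allFin n)

-- Connectivity

module _ {G : Graph n} where

  reach-start : ∀ {A u w} → Reach G A u w → A u ≡ true
  reach-start (here Au)     = Au
  reach-start (step Au _ _) = Au

  reach-mono : ∀ {A B : VSet n} → (∀ x → B x ≡ true → A x ≡ true) → ∀ {u w} → Reach G B u w → Reach G A u w
  reach-mono B⊆A (here Bu)          = here (B⊆A _ Bu)
  reach-mono B⊆A (step Bu u~x rest) = step (B⊆A _ Bu) u~x (reach-mono B⊆A rest)

module _ {H : Graph n} {G : Graph m} {r v f} (e : IsEmbedding H G r v f) where

  open IsEmbedding e

  reach-pullback : ∀ {A u w} → (∀ x → A x ≡ true → ∃ λ i → f i ≡ x) → Reach H A u w →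
    ∀ {i k} → f i ≡ u → f k ≡ w → Reach G (λ _ → true) i k
  reach-pullback A⊆image (here _) fi≡u fk≡w = subst (Reach G _ _) (injective (trans fi≡u (sym fk≡w))) (here refl)
  reach-pullback A⊆image (step {w = x} _ u~x rest) {i} fi≡u fk≡w with A⊆image x (reach-start rest)
  ... | l , fl≡x = step refl (trans (adj-preserved i l) (trans (cong₂ (adj H) fi≡u fl≡x) u~x)) (reach-pullback A⊆image rest fl≡x fk≡w)

embedded-connected : ∀ {k} {H : Graph n} {G : Graph m} {r v f} → KConnected k H → n ∸ m < k →
  IsEmbedding H G r v f → Connected G
embedded-connected {n} {k = k} {f = f} (_ , k-connected) few-outside e i l =
  reach-pullback e inside (k-connected outside |outside|<k (f i) (f l) (image-in i) (image-in l)) refl refl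
  where
  outside : VSet n
  outside u = not (image f u)
  |outside|<k : size outside < k
  |outside|<k = subst (_< k) (sym (trans (length-filterᵇ outside (allFin n)) (∑-χ-not-image f (IsEmbedding.injective e)))) few-outside
  image-in : ∀ i → outside (f i) ≡ false
  image-in i = cong not (image-∋ f i)
  inside : ∀ x → not (outside x) ≡ true → ∃ λ i → f i ≡ x
  inside x in-x = image-sound f (trans (sym (Bool.not-involutive (image f x))) in-x)

_─_ : VSet n → Fin n → VSet n
(A ─ u) x = A x ∧ not ⌊ x ≟ u ⌋

─-keeps : ∀ {A : VSet n} {u x} → A x ≡ true → x ≢ u → (A ─ u) x ≡ true
─-keeps {u = u} {x} Ax x≢u = cong₂ _∧_ Ax (cong not (⌊⌋-false (x ≟ u) x≢u))

─-⊆ : ∀ {A : VSet n} {u} x → (A ─ u) x ≡ true → A x ≡ true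
─-⊆ {A = A} x A─ux with A x
... | true = refl

─-shrinks : ∀ {A : VSet n} {u} → A u ≡ true → size (A ─ u) < size A
─-shrinks {n} {A} {u} Au rewrite length-filterᵇ (A ─ u) (allFin n) | length-filterᵇ A (allFin n) =
  ∑-mono-< pointwise (∈-allFin u) at-u
  where
  pointwise : ∀ x → χ ((A ─ u) x) ≤ χ (A x)
  pointwise x with A x
  ... | true  = χ≤1 _
  ... | false = z≤n
  at-u : χ ((A ─ u) u) < χ (A u)
  at-u rewrite Au | ⌊⌋-true (u ≟ u) refl = s≤s z≤n

module _ (G : Graph n) where

  -- Cut the walk after its last visit to u.
  avoid : ∀ {A u x w} → u ≢ w → Reach G A x w →
    Reach G (A ─ u) x w ⊎ ∃ λ y → adj G u y ≡ true × Reach G (A ─ u) y w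
  avoid {A} {u} u≢w (here Aw) = inj₁ (here (─-keeps {A = A} Aw (u≢w ∘ sym)))
  avoid {A} {u} u≢w (step {u = x} {w = y} Ax x~y rest) with avoid u≢w rest
  ... | inj₂ after-u = inj₂ after-u
  ... | inj₁ rest′ with x ≟ u
  ...   | yes refl = inj₂ (y , x~y , rest′)
  ...   | no x≢u   = inj₁ (step (─-keeps {A = A} Ax x≢u) x~y rest′)

  -- The fuel t bounds the number of allowed vertices, and each step forbids one more.
  reach? : ∀ t (A : VSet n) → size A ≤ t → ∀ u w → Dec (Reach G A u w)
  reach? t A |A|≤t u w with A u in Au | u ≟ w
  ... | false | _        = no λ walk → contradiction (trans (sym (reach-start walk)) Au) λ ()
  ... | true  | yes refl = yes (here Au)
  ... | true  | no u≢w with t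
  ...   | zero   = contradiction (<-≤-trans (─-shrinks {A = A} Au) |A|≤t) λ ()
  ...   | suc t′ = map′ (λ (y , u~y , walk) → step Au u~y (reach-mono ─-⊆ walk)) leave
                        (Fin.any? λ y → adj G u y Bool.≟ true ×-dec reach? t′ (A ─ u) smaller y w)
    where
    smaller : size (A ─ u) ≤ t′
    smaller = ≤-pred (<-≤-trans (─-shrinks {A = A} Au) |A|≤t)
    leave : Reach G A u w → ∃ λ y → adj G u y ≡ true × Reach G (A ─ u) y w
    leave (here _)           = contradiction refl u≢w
    leave (step _ u~y rest) with avoid u≢w rest
    ... | inj₁ rest′   = _ , u~y , rest′
    ... | inj₂ after-u = after-u

connected? : (G : Graph n) → Dec (Connected G)
connected? {n} G = Fin.all? λ u → Fin.all? λ w → reach? G n (λ _ → true) everything u w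
  where
  everything : size {n} (λ _ → true) ≤ n
  everything = ≤-reflexive (trans (length-filterᵇ (λ _ → true) (allFin n)) (∑-allFin-1 n))

-- Recovering the smaller graphlet degrees

_/#Aut_ : ℕ → Graphlet m → ℕ
x /#Aut g = _/_ x (#Aut (graph g) (root g)) {{>-nonZero (#Aut-positive (graph g) (root g))}}

*#Aut/#Aut : ∀ x (g : Graphlet m) → (x * #Aut (graph g) (root g)) /#Aut g ≡ x
*#Aut/#Aut x g = m*n/n≡m x (#Aut (graph g) (root g)) {{>-nonZero (#Aut-positive (graph g) (root g))}}

module FromGddRow {N : ℕ} (N≤n : N ≤ n) (M : Graphlet N → ℕ) where

  #Emb-top : Graph N → Fin N → ℕ
  #Emb-top G r with connected? G
  ... | yes c = M (record { graph = G ; root = r ; connected = c }) * #Aut G r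
  ... | no _  = 0

  outside-nonZero : ∀ d {j} → suc d + j ≡ N → NonZero (n ∸ j)
  outside-nonZero d {j} eq = >-nonZero (m<n⇒0<n∸m (<-≤-trans (subst (j <_) eq (s≤s (m≤n+m j d))) N≤n))

  #Emb-descend : ∀ d {j} → d + j ≡ N → Graph j → Fin j → ℕ
  #Emb-descend zero    refl G r = #Emb-top G r
  #Emb-descend (suc d) {j} eq G r =
    _/_ (∑[ nbr ∈ allFuns j (true ∷ false ∷ []) ] #Emb-descend d (trans (+-suc d j) eq) (extend G nbr) (suc r)) (n ∸ j)
        {{outside-nonZero d eq}}

module _ {N k : ℕ} (N≤n : N ≤ n) (few-outside : n ∸ N < k) (H : Graph n) (H-conn : KConnected k H) (v : Fin n) where

  open FromGddRow N≤n (λ g → graphletDegree H g v)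

  #Emb-top-correct : ∀ G r → #Emb-top G r ≡ #Emb H G r v
  #Emb-top-correct G r with connected? G
  ... | yes c = graphletDegree*#Aut H (record { graph = G ; root = r ; connected = c }) v
  ... | no ¬c = sym (#Emb-none λ f e → ¬c (embedded-connected H-conn few-outside e))

  #Emb-descend-correct : ∀ d {j} (eq : d + j ≡ N) G r → #Emb-descend d eq G r ≡ #Emb H G r v
  #Emb-descend-correct zero    refl G r = #Emb-top-correct G r
  #Emb-descend-correct (suc d) {j} eq G r = begin
    (∑[ nbr ∈ nbrs ] #Emb-descend d eq′ (extend G nbr) (suc r)) / (n ∸ j)  ≡⟨ cong (_/ (n ∸ j)) (∑-cong (λ nbr → #Emb-descend-correct d eq′ (extend G nbr) (suc r)) nbrs) ⟩
    (∑[ nbr ∈ nbrs ] #Emb H (extend G nbr) (suc r) v) / (n ∸ j)            ≡⟨ cong (_/ (n ∸ j)) (#Emb-extend H G r v) ⟩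
    #Emb H G r v * (n ∸ j) / (n ∸ j)                                         ≡⟨ m*n/n≡m (#Emb H G r v) (n ∸ j) ⟩
    #Emb H G r v                                                             ∎
    where
    open ≡-Reasoning
    nbrs : List (Fin j → Bool)
    nbrs = allFuns j (true ∷ false ∷ [])
    eq′ : d + suc j ≡ N
    eq′ = trans (+-suc d j) eq
    instance
      _ : NonZero (n ∸ j)
      _ = outside-nonZero d eq

top-size-bounds : ∀ {n k} → 1 ≤ k → k ≤ n → n ∸ k + 1 ≤ n × n ∸ (n ∸ k + 1) < k
top-size-bounds {n} {k} 1≤k k≤n = N≤n , subst (n ∸ (n ∸ k + 1) <_) (m∸[m∸n]≡n k≤n) (∸-monoʳ-< (m<m+n (n ∸ k) (s≤s z≤n)) N≤n)
  where
  N≤n : n ∸ k + 1 ≤ n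
  N≤n = ≤-trans (+-monoʳ-≤ (n ∸ k) 1≤k) (≤-reflexive (m∸n+n≡m k≤n))

mainTheorem6 : ∀ (n k : ℕ) → 2 ≤ k → k ≤ n ∸ 1 →
    Σ ((Fin n → Graphlet (n ∸ k + 1) → ℕ) → (Fin n → GraphletUpTo (n ∸ k) → ℕ)) (λ Φ →
      ∀ (H : Graph n) → KConnected k H →
        ∀ (v : Fin n) (g : GraphletUpTo (n ∸ k)) →
          gddUpTo (n ∸ k) H v g ≡ Φ (gdd (n ∸ k + 1) H) v g)
mainTheorem6 n k 2≤k k≤n-1 = Φ , correct
  where
  N : ℕ
  N = n ∸ k + 1
  bounds : N ≤ n × n ∸ N < k
  bounds = top-size-bounds (≤-trans (s≤s z≤n) 2≤k) (≤-trans k≤n-1 (m∸n≤m n 1))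
  N≤n : N ≤ n
  N≤n = proj₁ bounds
  fits : ∀ {j} → j ≤ n ∸ k → N ∸ j + j ≡ N
  fits j≤n-k = m∸n+n≡m (≤-trans j≤n-k (m≤m+n (n ∸ k) 1))

  Φ : (Fin n → Graphlet N → ℕ) → Fin n → GraphletUpTo (n ∸ k) → ℕ
  Φ M v (j , j≤n-k , g) = FromGddRow.#Emb-descend N≤n (M v) (N ∸ j) (fits j≤n-k) (graph g) (root g) /#Aut g

  correct : ∀ H → KConnected k H → ∀ v g → gddUpTo (n ∸ k) H v g ≡ Φ (gdd N H) v g
  correct H H-conn v (j , j≤n-k , g) = begin
    graphletDegree H g v                                  ≡⟨ *#Aut/#Aut (graphletDegree H g v) g ⟨
    (graphletDegree H g v * #Aut (graph g) (root g)) /#Aut g ≡⟨ cong (_/#Aut g) (graphletDegree*#Aut H g v) ⟩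
    #Emb H (graph g) (root g) v /#Aut g                   ≡⟨ cong (_/#Aut g) (#Emb-descend-correct N≤n (proj₂ bounds) H H-conn v (N ∸ j) (fits j≤n-k) (graph g) (root g)) ⟨
    Φ (gdd N H) v (j , j≤n-k , g)                         ∎
    where open ≡-Reasoning
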